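{- Let $\tau,k>0$ be integers, let $V$ be a finite set with $n=|V|>k$, and let $\mathcal{G}=(V,\{C_1,\dots,C_\tau\},\binom{V}{2})$. Suppose that for all subsets $S_1,\dots,S_\tau\subseteq V$ with $\sum_{i=1}^\tau|S_i|=k$ and every $u\notin\bigcup_{i\in[\tau]}S_i$ we have $$\Big|\{u\}\cup\bigcup_{i=1}^{\tau}\bigcup_{v\in S_i}N_{C_i}[v]\Big|<n.$$ Then the multi-layer cop number of $\mathcal{G}$ is strictly greater than $k$.
   Context: A multi-layer graph with designated layers is $(V,\{C_1,\dots,C_\tau\},R)$ with cop layers $C_i\subseteq\binom V2$ and robber layer $R\subseteq\binom V2$; here $R=\binom V2$. Game with an allocation $(k_1,\dots,k_\tau)$: $k_i$ cops are assigned to $C_i$; cops are placed on vertices first, then the robber; turns alternate starting with the cops; on the cops' turn each cop stays or moves along one edge of its own layer; the robber stays or moves along one edge of $R$; the cops win if a cop ever occupies the robber's vertex. The multi-layer cop number is the least $k$ such that some allocation with $\sum_i k_i=k$ gives the cop player a winning strategy. $N_{C_i}[v]=\{w: vw\in C_i\}\cup\{v\}$ is the closed neighbourhood of $v$ in layer $C_i$. -}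

module Defs where

open import Data.Nat using (ℕ; zero; suc; _+_)
open import Data.Fin using (Fin; zero; suc; _≟_)
open import Data.Bool using (Bool; true; false; _∨_; _∧_)
open import Data.Vec using (Vec; tabulate; lookup)
open import Data.List using (List; []; _∷_)
open import Data.Product using (Σ; ∃; _×_; _,_)
open import Data.Sum using (_⊎_)
open import Data.Fin.Subset using (Subset)
open import Relation.Nullary.Decidable using (⌊_⌋)
open import Relation.Binary.PropositionalEquality using (_≡_)
open import Relation.Nullary using (¬_)

sumFin : {m : ℕ} → (Fin m → ℕ) → ℕ
sumFin {zero}  f = 0
sumFin {suc m} f = f zero + sumFin (λ i → f (suc i))

anyFin : {m : ℕ} → (Fin m → Bool) → Bool
anyFin {zero}  f = false
anyFin {suc m} f = f zero ∨ anyFin (λ i → f (suc i))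

-- Vertex set V = Fin n.  A cop layer C_i ⊆ binom(V,2) is represented by
-- a Boolean adjacency function, required to be symmetric and irreflexive.
Layers : ℕ → ℕ → Set
Layers τ n = Fin τ → Fin n → Fin n → Bool

IsLayerFamily : {τ n : ℕ} → Layers τ n → Set
IsLayerFamily {τ} {n} C =
  ((i : Fin τ) (v w : Fin n) → C i v w ≡ C i w v) ×
  ((i : Fin τ) (v : Fin n) → C i v v ≡ false)

N[_,_] : {τ n : ℕ} → Layers τ n → Fin τ → Fin n → Subset n
N[ C , i ] v = tabulate (λ w → C i v w ∨ ⌊ v ≟ w ⌋)

NbhdUnion : {τ n : ℕ} → Layers τ n → (Fin τ → Subset n) → Subset n
NbhdUnion {τ} {n} C S =
  tabulate (λ w → anyFin (λ i → anyFin (λ v → lookup (S i) v ∧ lookup (N[ C , i ] v) w)))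

UnionS : {τ n : ℕ} → (Fin τ → Subset n) → Subset n
UnionS {τ} {n} S = tabulate (λ w → anyFin (λ i → lookup (S i) w))

-- The game.  The robber layer is R = binom(V,2) (complete graph), so the
-- robber may move to any vertex (or stay) in one move.

Config : {τ : ℕ} → ℕ → (Fin τ → ℕ) → Set
Config {τ} n ks = (i : Fin τ) → Fin (ks i) → Fin n

LegalCopMove : {τ n : ℕ} → Layers τ n → {ks : Fin τ → ℕ} → Config n ks → Config n ks → Set
LegalCopMove {τ} C {ks} c c' =
  (i : Fin τ) (j : Fin (ks i)) → (c' i j ≡ c i j) ⊎ (C i (c i j) (c' i j) ≡ true)

Caught : {τ n : ℕ} {ks : Fin τ → ℕ} → Config n ks → Fin n → Set
Caught {τ} {n} {ks} c r = Σ (Fin τ) λ i → Σ (Fin (ks i)) λ j → c i j ≡ r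

-- Histories: lists of completed rounds (cop config, robber position),
-- most recent first.
History : {τ : ℕ} → ℕ → (Fin τ → ℕ) → Set
History n ks = List (Config n ks × Fin n)

record CopStrategy {τ n : ℕ} (C : Layers τ n) (ks : Fin τ → ℕ) : Set where
  field
    place : Config n ks
    move  : History n ks → Config n ks → Fin n → Config n ks
    legal : (h : History n ks) (c : Config n ks) (r : Fin n) → LegalCopMove C c (move h c r)

record RobberStrategy {τ : ℕ} (n : ℕ) (ks : Fin τ → ℕ) : Set where
  field
    place : Config n ks → Fin n
    move  : History n ks → Fin n → Config n ks → Fin n

play : {τ n : ℕ} {C : Layers τ n} {ks : Fin τ → ℕ} →
       CopStrategy C ks → RobberStrategy n ks → ℕ →
       History n ks × Config n ks × Fin n
play σ ρ zero = [] , CopStrategy.place σ , RobberStrategy.place ρ (CopStrategy.place σ)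
play σ ρ (suc t) with play σ ρ t
... | h , c , r =
  let c' = CopStrategy.move σ h c r in
  ((c , r) ∷ h) , c' , RobberStrategy.move ρ ((c , r) ∷ h) r c'

-- The cops win the play if at some time a cop occupies the robber's vertex:
-- either after the robber's placement/move (round t position), or right
-- after the cops' move in round t+1 (before the robber answers).
CopsWinPlay : {τ n : ℕ} {C : Layers τ n} {ks : Fin τ → ℕ} →
              CopStrategy C ks → RobberStrategy n ks → Set
CopsWinPlay σ ρ = ∃ λ t → Pos (play σ ρ t)
  where
  Pos : _ → Set
  Pos (h , c , r) = Caught c r ⊎ Caught (CopStrategy.move σ h c r) r

CopsWin : {τ n : ℕ} → Layers τ n → (Fin τ → ℕ) → Set
CopsWin {τ} {n} C ks = Σ (CopStrategy C ks) λ σ → (ρ : RobberStrategy n ks) → CopsWinPlay σ ρ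

-- The robber stays on a vertex outside the closed neighbourhoods of all cops.
-- Since the robber layer is complete, he can always jump to such a vertex,
-- and from there no cop can reach him in one move.  Such a vertex exists for
-- every placement of at most k cops: enlarge the sets of occupied vertices
-- S_i to total size exactly k, choose u outside their union (possible since
-- k < n), and the hypothesis leaves a vertex outside {u} ∪ ⋃ N_{C_i}[S_i].
module Submission where

open import Defs
open import Data.Bool using (Bool; true; false; _∨_; _∧_)
open import Data.Bool.Properties using (∨-zeroʳ)
open import Data.Fin using (Fin; zero; suc; _≟_)
open import Data.Fin.Properties using (¬Fin0)
open import Data.Fin.Subset using (Subset; ∣_∣; ⁅_⁆; _∪_; _∈_; _∉_; _⊆_; _⊂_; ⊥; outside; inside)
open import Data.Fin.Subset.Properties
  using (drop-there; ∣⊥∣≡0; ∣⁅x⁆∣≡1; x∈⁅x⁆; ⊆-refl; ⊆-trans; p⊆p∪q; q⊆p∪q;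
         x∈p∪q⁺; p⊆q⇒∣p∣≤∣q∣; p⊂q⇒∣p∣<∣q∣)
open import Data.Nat using (ℕ; zero; suc; _+_; _∸_; _<_; _≤_; z≤n; s≤s)
open import Data.Nat.Properties
  using (≤-trans; ≤-reflexive; ≤-antisym; <⇒≤; ≤-<-trans; n≤1+n; +-suc; +-comm; +-assoc;
         +-mono-≤; +-monoʳ-≤; m≤m+n; m≤n+m; m∸n+n≡m)
open import Data.Product using (∃; _×_; _,_; proj₁; proj₂)
import Data.Product as Product
open import Data.Sum using (inj₁; inj₂)
open import Data.Vec using ([]; _∷_; tabulate)
open import Data.Vec.Properties using (lookup∘tabulate; []=⇒lookup; lookup⇒[]=)
open import Function using (_∘_; id)
open import Relation.Binary.PropositionalEquality
  using (_≡_; refl; sym; trans; cong; cong₂; subst; module ≡-Reasoning)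
open import Relation.Nullary using (¬_; contradiction)
open import Relation.Nullary.Decidable using (⌊_⌋; isYes≗does; dec-true)

private
  variable
    τ m n : ℕ

anyFin⁺ : (f : Fin m → Bool) {i : Fin m} → f i ≡ true → anyFin f ≡ true
anyFin⁺ f {zero}  fi rewrite fi = refl
anyFin⁺ f {suc i} fi = trans (cong (f zero ∨_) (anyFin⁺ (f ∘ suc) fi)) (∨-zeroʳ (f zero))

anyFin⁻ : (f : Fin m → Bool) → anyFin f ≡ true → ∃ λ i → f i ≡ true
anyFin⁻ {suc m} f any with f zero in f0
... | true  = zero , f0
... | false = Product.map suc id (anyFin⁻ (f ∘ suc) any)

sumFin-mono : {f g : Fin m → ℕ} → (∀ i → f i ≤ g i) → sumFin f ≤ sumFin g
sumFin-mono {zero}  f≤g = z≤n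
sumFin-mono {suc m} f≤g = +-mono-≤ (f≤g zero) (sumFin-mono (f≤g ∘ suc))

∈-tabulate⁺ : {f : Fin n → Bool} {x : Fin n} → f x ≡ true → x ∈ tabulate f
∈-tabulate⁺ {f = f} {x} fx = lookup⇒[]= x (tabulate f) (trans (lookup∘tabulate f x) fx)

∈-tabulate⁻ : {f : Fin n → Bool} {x : Fin n} → x ∈ tabulate f → f x ≡ true
∈-tabulate⁻ {f = f} {x} x∈ = trans (sym (lookup∘tabulate f x)) ([]=⇒lookup x∈)

∣p∪q∣≤∣p∣+∣q∣ : (p q : Subset n) → ∣ p ∪ q ∣ ≤ ∣ p ∣ + ∣ q ∣
∣p∪q∣≤∣p∣+∣q∣ []            []            = z≤n
∣p∪q∣≤∣p∣+∣q∣ (outside ∷ p) (outside ∷ q) = ∣p∪q∣≤∣p∣+∣q∣ p q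
∣p∪q∣≤∣p∣+∣q∣ (inside  ∷ p) (outside ∷ q) = s≤s (∣p∪q∣≤∣p∣+∣q∣ p q)
∣p∪q∣≤∣p∣+∣q∣ (outside ∷ p) (inside  ∷ q) =
  ≤-trans (s≤s (∣p∪q∣≤∣p∣+∣q∣ p q)) (≤-reflexive (sym (+-suc ∣ p ∣ ∣ q ∣)))
∣p∪q∣≤∣p∣+∣q∣ (inside  ∷ p) (inside  ∷ q) =
  s≤s (≤-trans (∣p∪q∣≤∣p∣+∣q∣ p q) (+-monoʳ-≤ ∣ p ∣ (n≤1+n ∣ q ∣)))

∣p∣<n⇒∃∉ : (p : Subset n) → ∣ p ∣ < n → ∃ λ x → x ∉ p
∣p∣<n⇒∃∉ (outside ∷ p) _       = zero , λ ()
∣p∣<n⇒∃∉ (inside  ∷ p) (s≤s ∣p∣<n) =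
  Product.map suc (λ x∉p → x∉p ∘ drop-there) (∣p∣<n⇒∃∉ p ∣p∣<n)

x∉p⇒∣p∪⁅x⁆∣≡1+∣p∣ : (p : Subset n) {x : Fin n} → x ∉ p → ∣ p ∪ ⁅ x ⁆ ∣ ≡ suc ∣ p ∣
x∉p⇒∣p∪⁅x⁆∣≡1+∣p∣ p {x} x∉p = ≤-antisym upper (p⊂q⇒∣p∣<∣q∣ p⊂p∪⁅x⁆)
  where
  upper : ∣ p ∪ ⁅ x ⁆ ∣ ≤ suc ∣ p ∣
  upper = subst (∣ p ∪ ⁅ x ⁆ ∣ ≤_) (trans (cong (∣ p ∣ +_) (∣⁅x⁆∣≡1 x)) (+-comm ∣ p ∣ 1))
                (∣p∪q∣≤∣p∣+∣q∣ p ⁅ x ⁆)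
  p⊂p∪⁅x⁆ : p ⊂ p ∪ ⁅ x ⁆
  p⊂p∪⁅x⁆ = p⊆p∪q ⁅ x ⁆ , x , q⊆p∪q p ⁅ x ⁆ (x∈⁅x⁆ x) , x∉p

⊆-extend : (d : ℕ) (p : Subset n) → d + ∣ p ∣ ≤ n → ∃ λ q → p ⊆ q × ∣ q ∣ ≡ d + ∣ p ∣
⊆-extend         zero    p _ = p , ⊆-refl , refl
⊆-extend {n = n} (suc d) p 1+d+∣p∣≤n with ∣p∣<n⇒∃∉ p (≤-trans (s≤s (m≤n+m ∣ p ∣ d)) 1+d+∣p∣≤n)
... | x , x∉p =
  Product.map₂ (Product.map (⊆-trans (p⊆p∪q ⁅ x ⁆)) (λ ∣q∣≡ → trans ∣q∣≡ d+∣p′∣≡1+d+∣p∣))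
               (⊆-extend d (p ∪ ⁅ x ⁆) (subst (_≤ n) (sym d+∣p′∣≡1+d+∣p∣) 1+d+∣p∣≤n))
  where
  d+∣p′∣≡1+d+∣p∣ : d + ∣ p ∪ ⁅ x ⁆ ∣ ≡ suc d + ∣ p ∣
  d+∣p′∣≡1+d+∣p∣ = trans (cong (d +_) (x∉p⇒∣p∪⁅x⁆∣≡1+∣p∣ p x∉p)) (+-suc d ∣ p ∣)

-- Only the first set is enlarged; this is where τ > 0 is needed.
⊆-extendFamily : {k : ℕ} (T : Fin (suc τ) → Subset n) →
                 sumFin (λ i → ∣ T i ∣) ≤ k → k ≤ n →
                 ∃ λ S → (∀ i → T i ⊆ S i) × sumFin (λ i → ∣ S i ∣) ≡ k
⊆-extendFamily {τ = τ} {n = n} {k = k} T ΣT≤k k≤n = S , T⊆S , ΣS≡k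
  where
  open ≡-Reasoning
  rest = sumFin (λ i → ∣ T (suc i) ∣)
  ΣT = ∣ T zero ∣ + rest
  d = k ∸ ΣT
  extension = ⊆-extend d (T zero)
    (≤-trans (+-monoʳ-≤ d (m≤m+n ∣ T zero ∣ rest)) (≤-trans (≤-reflexive (m∸n+n≡m ΣT≤k)) k≤n))
  S : Fin (suc τ) → Subset n
  S zero    = proj₁ extension
  S (suc i) = T (suc i)
  T⊆S : ∀ i → T i ⊆ S i
  T⊆S zero    = proj₁ (proj₂ extension)
  T⊆S (suc i) = ⊆-refl
  ΣS≡k : sumFin (λ i → ∣ S i ∣) ≡ k
  ΣS≡k = begin
    ∣ S zero ∣ + rest     ≡⟨ cong (_+ rest) (proj₂ (proj₂ extension)) ⟩
    d + ∣ T zero ∣ + rest  ≡⟨ +-assoc d ∣ T zero ∣ rest ⟩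
    d + ΣT                 ≡⟨ m∸n+n≡m ΣT≤k ⟩
    k                      ∎

image : (Fin m → Fin n) → Subset n
image {zero}  f = ⊥
image {suc m} f = ⁅ f zero ⁆ ∪ image (f ∘ suc)

∣image∣≤m : (f : Fin m → Fin n) → ∣ image f ∣ ≤ m
∣image∣≤m {zero}  {n} f = ≤-reflexive (∣⊥∣≡0 n)
∣image∣≤m {suc m}     f = ≤-trans (∣p∪q∣≤∣p∣+∣q∣ ⁅ f zero ⁆ (image (f ∘ suc)))
                                  (+-mono-≤ (≤-reflexive (∣⁅x⁆∣≡1 (f zero))) (∣image∣≤m (f ∘ suc)))

∈image : (f : Fin m → Fin n) (j : Fin m) → f j ∈ image f
∈image f zero    = p⊆p∪q (image (f ∘ suc)) (x∈⁅x⁆ (f zero))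
∈image f (suc j) = q⊆p∪q ⁅ f zero ⁆ (image (f ∘ suc)) (∈image (f ∘ suc) j)

∈UnionS⁺ : (S : Fin τ → Subset n) {i : Fin τ} {x : Fin n} → x ∈ S i → x ∈ UnionS S
∈UnionS⁺ S {i} x∈Sᵢ = ∈-tabulate⁺ (anyFin⁺ _ {i} ([]=⇒lookup x∈Sᵢ))

∈UnionS⁻ : (S : Fin τ → Subset n) {x : Fin n} → x ∈ UnionS S → ∃ λ i → x ∈ S i
∈UnionS⁻ S {x} x∈ = Product.map₂ (lookup⇒[]= x _) (anyFin⁻ _ (∈-tabulate⁻ x∈))

∣UnionS∣≤sum : (S : Fin τ → Subset n) → ∣ UnionS S ∣ ≤ sumFin (λ i → ∣ S i ∣)
∣UnionS∣≤sum {zero}  {n} S =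
  ≤-trans (p⊆q⇒∣p∣≤∣q∣ {q = ⊥} (λ x∈ → contradiction (proj₁ (∈UnionS⁻ S x∈)) ¬Fin0))
          (≤-reflexive (∣⊥∣≡0 n))
∣UnionS∣≤sum {suc τ}     S =
  ≤-trans (p⊆q⇒∣p∣≤∣q∣ UnionS⊆) (≤-trans (∣p∪q∣≤∣p∣+∣q∣ (S zero) (UnionS (S ∘ suc)))
                                         (+-monoʳ-≤ ∣ S zero ∣ (∣UnionS∣≤sum (S ∘ suc))))
  where
  UnionS⊆ : UnionS S ⊆ S zero ∪ UnionS (S ∘ suc)
  UnionS⊆ x∈ with ∈UnionS⁻ S x∈
  ... | zero  , x∈S₀ = x∈p∪q⁺ (inj₁ x∈S₀)
  ... | suc i , x∈Sᵢ = x∈p∪q⁺ (inj₂ (∈UnionS⁺ (S ∘ suc) x∈Sᵢ))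

module _ (C : Layers τ n) where

  v∈N[v] : (i : Fin τ) (v : Fin n) → v ∈ N[ C , i ] v
  v∈N[v] i v = ∈-tabulate⁺ (trans (cong (C i v v ∨_) ⌊v≟v⌋) (∨-zeroʳ (C i v v)))
    where
    ⌊v≟v⌋ : ⌊ v ≟ v ⌋ ≡ true
    ⌊v≟v⌋ = trans (isYes≗does (v ≟ v)) (dec-true (v ≟ v) refl)

  adjacent⇒∈N[] : (i : Fin τ) {v w : Fin n} → C i v w ≡ true → w ∈ N[ C , i ] v
  adjacent⇒∈N[] i adj = ∈-tabulate⁺ (cong (_∨ _) adj)

  ∈NbhdUnion⁺ : (S : Fin τ → Subset n) {i : Fin τ} {v w : Fin n} →
                v ∈ S i → w ∈ N[ C , i ] v → w ∈ NbhdUnion C S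
  ∈NbhdUnion⁺ S {i} {v} v∈Sᵢ w∈N[v] =
    ∈-tabulate⁺ (anyFin⁺ _ {i} (anyFin⁺ _ {v} (cong₂ _∧_ ([]=⇒lookup v∈Sᵢ) ([]=⇒lookup w∈N[v]))))

  NoDominatingPlacement : ℕ → Set
  NoDominatingPlacement k =
    (S : Fin τ → Subset n) → sumFin (λ i → ∣ S i ∣) ≡ k →
    (u : Fin n) → u ∉ UnionS S → ∣ ⁅ u ⁆ ∪ NbhdUnion C S ∣ < n

  module _ {ks : Fin τ → ℕ} where

    Safe : Config n ks → Fin n → Set
    Safe c r = (i : Fin τ) (j : Fin (ks i)) → r ∉ N[ C , i ] (c i j)

    Safe⇒¬Caught : {c : Config n ks} {r : Fin n} → Safe c r → ¬ Caught c r
    Safe⇒¬Caught safe (i , j , refl) = safe i j (v∈N[v] i _)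

    Safe⇒¬Caught-afterMove : {c c′ : Config n ks} {r : Fin n} →
                              LegalCopMove C c c′ → Safe c r → ¬ Caught c′ r
    Safe⇒¬Caught-afterMove legal safe (i , j , refl) with legal i j
    ... | inj₁ stay = Safe⇒¬Caught safe (i , j , sym stay)
    ... | inj₂ adj  = safe i j (adjacent⇒∈N[] i adj)

    evader : ((c : Config n ks) → ∃ (Safe c)) → RobberStrategy n ks
    evader escape = record
      { place = proj₁ ∘ escape
      ; move  = λ _ _ c′ → proj₁ (escape c′)
      }

    module _ (escape : (c : Config n ks) → ∃ (Safe c)) (σ : CopStrategy C ks) where

      evader-safe : (t : ℕ) → let (_ , c , r) = play σ (evader escape) t in Safe c r
      evader-safe zero = proj₂ (escape (CopStrategy.place σ))
      evader-safe (suc t) with play σ (evader escape) t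
      ... | h , c , r = proj₂ (escape (CopStrategy.move σ h c r))

      evader-survives : ¬ CopsWinPlay σ (evader escape)
      evader-survives (t , caught) with play σ (evader escape) t | evader-safe t
      ... | h , c , r | safe with caught
      ... | inj₁ now       = Safe⇒¬Caught safe now
      ... | inj₂ afterMove = Safe⇒¬Caught-afterMove (CopStrategy.legal σ h c r) safe afterMove

    evader-wins : ((c : Config n ks) → ∃ (Safe c)) → ¬ CopsWin C ks
    evader-wins escape (σ , σ-wins) = evader-survives escape σ (σ-wins (evader escape))

safe-vertex : {k : ℕ} (C : Layers (suc τ) n) {ks : Fin (suc τ) → ℕ} →
              NoDominatingPlacement C k → k < n → sumFin ks ≤ k →
              (c : Config n ks) → ∃ (Safe C c)
safe-vertex {n = n} C small k<n Σks≤k c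
  with S , image⊆S , ΣS≡k ← ⊆-extendFamily (image ∘ c)
                              (≤-trans (sumFin-mono (∣image∣≤m ∘ c)) Σks≤k) (<⇒≤ k<n)
  with u , u∉ ← ∣p∣<n⇒∃∉ (UnionS S) (≤-<-trans (∣UnionS∣≤sum S) (subst (_< n) (sym ΣS≡k) k<n))
  with w , w∉ ← ∣p∣<n⇒∃∉ (⁅ u ⁆ ∪ NbhdUnion C S) (small S ΣS≡k u u∉)
  = w , λ i j w∈N → w∉ (q⊆p∪q ⁅ u ⁆ (NbhdUnion C S)
                         (∈NbhdUnion⁺ C S (image⊆S i (∈image (c i) j)) w∈N))

lemma5p2 : (τ k n : ℕ) → 0 < τ → 0 < k → k < n →
    (C : Layers τ n) → IsLayerFamily C →
    ((S : Fin τ → Subset n) → sumFin (λ i → ∣ S i ∣) ≡ k →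
      (u : Fin n) → u ∉ UnionS S → ∣ ⁅ u ⁆ ∪ NbhdUnion C S ∣ < n) →
    (ks : Fin τ → ℕ) → sumFin ks ≤ k → ¬ CopsWin C ks
lemma5p2 (suc τ) k n _ _ k<n C _ small ks Σks≤k =
  evader-wins C (safe-vertex C small k<n Σks≤k)
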